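{- Let $K$ be a finite group containing a normal subgroup $E \cong C_2^r$, with characters $\{\chi_u : u \in U_r\}$, and suppose $\{A_u : u \in U_r\}$ is a signature set on $K$ with respect to $E$. For each $u\in U_r$ let $B_u = A_u\chi_u \in \mathbb{Z}K$. Then: (i) for each $u \in U_r$, $B_u$ is a $\{\pm1\}$-valued function on $K$; (ii) for all $u,v \in U_r$, in $\mathbb{Z}K$ we have $B_uB_v^{(-1)} = |K|\chi_u$ if $u=v$ and $B_uB_v^{(-1)}=0$ if $u\neq v$.
   Context: Functions $K\to\mathbb{Z}$ are identified with elements of the group ring $\mathbb{Z}K$ via $F\leftrightarrow\sum_g F(g)g$; for $A=\sum a_g g$, $A^{(-1)}=\sum a_g g^{ -1}$. Let $E=\langle x_1,\dots,x_r\rangle\cong C_2^r$ and $U_r=\mathrm{GF}(2)^r$. For $u=(u_1,\dots,u_r)\in U_r$, the character $\chi_u$ of $E$ is identified with the group ring element $\chi_u=\prod_{i=1}^r(1+(-1)^{u_i}x_i)\in\mathbb{Z}E\subseteq \mathbb{Z}K$ (so $\chi_0=\sum_{e\in E}e$). A signature block on $K$ with respect to $\chi_u$ is an element $A_u\in\mathbb{Z}K$ which is a $\{\pm1\}$-valued function on some set of coset representatives for $E$ in $K$ (one element from each coset) and zero elsewhere, satisfying $A_u\chi_uA_u^{(-1)}=\frac{|K|}{2^r}\chi_u$ in $\mathbb{Z}K$. A signature set on $K$ with respect to $E$ is a multiset $\{A_u:u\in U_r\}$ where each $A_u$ is a signature block on $K$ with respect to $\chi_u$. -}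

module Defs where

open import Data.Nat as ℕ using (ℕ; zero; suc; _^_)
open import Data.Nat.Properties using (m^n≢0)
open import Data.Integer as ℤ using (ℤ; +_; -_; _+_; _*_; 0ℤ; 1ℤ; -1ℤ)
open import Data.Bool using (Bool; true; false; if_then_else_)
open import Data.Fin using (Fin; zero; suc)
open import Data.Vec using (Vec; lookup)
open import Data.List using (List; length; foldr; map)
open import Data.List.Membership.Propositional using (_∈_)
open import Data.List.Relation.Unary.Unique.Propositional using (Unique)
open import Data.Product using (Σ; _×_; ∃)
open import Data.Sum using (_⊎_)
open import Relation.Nullary using (¬_; Dec; does)
open import Relation.Binary.PropositionalEquality using (_≡_; _≢_)
open import Function using (_∘_)

record FinGroup : Set₁ where
  infixl 7 _·_
  field
    Carrier   : Set
    _·_       : Carrier → Carrier → Carrier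
    e         : Carrier
    inv       : Carrier → Carrier
    assoc     : ∀ a b c → (a · b) · c ≡ a · (b · c)
    identityˡ : ∀ a → e · a ≡ a
    identityʳ : ∀ a → a · e ≡ a
    inverseˡ  : ∀ a → inv a · a ≡ e
    inverseʳ  : ∀ a → a · inv a ≡ e
    _≟_       : (a b : Carrier) → Dec (a ≡ b)
    elems     : List Carrier
    complete  : ∀ a → a ∈ elems
    unique    : Unique elems

  order : ℕ
  order = length elems

open FinGroup public

module _ (K : FinGroup) where
  private
    C = Carrier K
    _∙_ = _·_ K

  infixl 7 _⊛_
  infixr 7 _•_
  infixl 6 _⊕_
  infix 4 _≈_

  ZK : Set
  ZK = C → ℤ

  sumK : (C → ℤ) → ℤ
  sumK f = foldr _+_ 0ℤ (map f (elems K))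

  δ : C → ZK
  δ g h = if does (_≟_ K g h) then 1ℤ else 0ℤ

  _⊕_ : ZK → ZK → ZK
  (F ⊕ G) g = F g + G g

  _•_ : ℤ → ZK → ZK
  (c • F) g = c * F g

  𝟘 : ZK
  𝟘 _ = 0ℤ

  _⊛_ : ZK → ZK → ZK
  (F ⊛ G) g = sumK (λ h → F h * G (inv K h ∙ g))

  _⁽⁻¹⁾ : ZK → ZK
  (F ⁽⁻¹⁾) g = F (inv K g)

  _≈_ : ZK → ZK → Set
  F ≈ G = ∀ g → F g ≡ G g

  prodZK : (n : ℕ) → (Fin n → ZK) → ZK
  prodZK zero    f = δ (e K)
  prodZK (suc n) f = f zero ⊛ prodZK n (f ∘ suc)

  IsPM1 : ℤ → Set
  IsPM1 z = z ≡ 1ℤ ⊎ z ≡ -1ℤ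

  -- U_r = GF(2)^r is modelled as Vec Bool r (true = 1).

  prodK : (n : ℕ) → (Fin n → C) → C
  prodK zero    f = e K
  prodK (suc n) f = f zero ∙ prodK n (f ∘ suc)

  embed : {r : ℕ} → (Fin r → C) → Vec Bool r → C
  embed {r} x u = prodK r (λ i → if lookup u i then x i else e K)

  -- E = ⟨x₁,…,x_r⟩ is a normal subgroup of K isomorphic to C₂^r:
  -- the x_i are commuting involutions, u ↦ ∏ x_i^{u_i} is injective
  -- (so E ≅ C₂^r with basis x_i), and E is normal in K.
  record IsNormalC2r (r : ℕ) (x : Fin r → C) : Set where
    field
      invol     : ∀ i → x i ∙ x i ≡ e K
      commute   : ∀ i j → x i ∙ x j ≡ x j ∙ x i
      injective : ∀ u v → embed x u ≡ embed x v → u ≡ v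
      normal    : ∀ k u → ∃ λ v → (k ∙ embed x u) ∙ inv K k ≡ embed x v

  χ : {r : ℕ} → (Fin r → C) → Vec Bool r → ZK
  χ {r} x u = prodZK r (λ i → δ (e K) ⊕ ((if lookup u i then -1ℤ else 1ℤ) • δ (x i)))

  indexE : ℕ → ℕ
  indexE r = ℕ._/_ (order K) (2 ^ r) {{m^n≢0 2 r}}

  -- A is a {±1}-valued function on a set of coset representatives of E in K
  -- (exactly one element from each coset gE) and zero elsewhere.
  IsOnCosetReps : {r : ℕ} → (Fin r → C) → ZK → Set
  IsOnCosetReps {r} x A =
      (∀ g → A g ≡ 0ℤ ⊎ IsPM1 (A g))
    × (∀ g → ∃ λ (w : Vec Bool r) → A (g ∙ embed x w) ≢ 0ℤ)
    × (∀ g (w w′ : Vec Bool r) → A (g ∙ embed x w) ≢ 0ℤ → A (g ∙ embed x w′) ≢ 0ℤ → w ≡ w′)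

  IsSignatureBlock : {r : ℕ} → (Fin r → C) → Vec Bool r → ZK → Set
  IsSignatureBlock {r} x u A =
    IsOnCosetReps x A × ((A ⊛ χ x u) ⊛ (A ⁽⁻¹⁾) ≈ ((+ indexE r) • χ x u))

  IsSignatureSet : {r : ℕ} → (Fin r → C) → (Vec Bool r → ZK) → Set
  IsSignatureSet x A = ∀ u → IsSignatureBlock x u (A u)

-- Write x^w = ∏ x_i^{w_i} for w ∈ U_r. Expanding the product gives χ_u = Σ_w (-1)^{u·w} x^w, so
-- (A χ_u)(g) = Σ_w (-1)^{u·w} A(g x^w); when A lives on one point of each coset gE exactly one term
-- survives, and B_u = A_u χ_u is ±1-valued. The factors 1 ± x_i of χ_u commute, and
-- (1 ± x_i)² = 2(1 ± x_i) and (1 + x_i)(1 - x_i) = 0, whence χ_u χ_u = 2^r χ_u, χ_u χ_v = 0 for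
-- u ≠ v, and χ_u^(-1) = χ_u. So B_u B_v^(-1) = A_u χ_u χ_v A_v^(-1) vanishes for u ≠ v and equals
-- 2^r (|K|/2^r) χ_u for u = v. The scalar is identified without dividing: at the identity,
-- B_u B_u^(-1) evaluates to Σ_g B_u(g)² = |K|, while χ_u takes the value 1.
module Submission where

import Defs
open import Defs using (FinGroup)
open import Level using (0ℓ)
open import Algebra.Bundles using (Group)
import Algebra.Properties.Group as GroupProperties
open import Data.Nat using (ℕ; zero; suc; _^_)
open import Data.Integer using (ℤ; +_; _+_; _*_; 0ℤ; 1ℤ; -1ℤ)
import Data.Integer.Properties as ℤ
open import Data.Integer.Tactic.RingSolver using (solve-∀)
open import Data.Bool using (Bool; true; false; if_then_else_)
open import Data.Fin using (Fin; zero; suc)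
open import Data.Vec using (Vec; []; _∷_; lookup; replicate)
open import Data.List using (List; []; _∷_; length; foldr; map)
open import Data.List.Membership.Propositional using (_∈_)
import Data.List.Relation.Unary.All as All
open import Data.List.Relation.Unary.Any using (here; there)
open import Data.List.Relation.Unary.Unique.Propositional using (Unique)
open import Data.List.Relation.Unary.AllPairs using (_∷_)
open import Data.Product using (_×_; _,_; proj₁; proj₂)
open import Data.Sum using (_⊎_; inj₁; inj₂)
open import Data.Empty using (⊥-elim)
open import Function using (_∘_)
open import Relation.Nullary using (Dec; yes; no)
open import Relation.Binary.PropositionalEquality
open import Relation.Binary.Bundles using (Setoid)
import Relation.Binary.Reasoning.Setoid
import Data.Bool
import Data.Vec

module _ {A : Set} where

  sumL : List A → (A → ℤ) → ℤ
  sumL l f = foldr _+_ 0ℤ (map f l)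

  sumL-cong : ∀ l {f g : A → ℤ} → (∀ a → f a ≡ g a) → sumL l f ≡ sumL l g
  sumL-cong []      f≗g = refl
  sumL-cong (a ∷ l) f≗g = cong₂ _+_ (f≗g a) (sumL-cong l f≗g)

  sumL-+ : ∀ l (f g : A → ℤ) → sumL l (λ a → f a + g a) ≡ sumL l f + sumL l g
  sumL-+ []      f g = refl
  sumL-+ (a ∷ l) f g =
    trans (cong (_+_ (f a + g a)) (sumL-+ l f g)) (interchange (f a) (g a) (sumL l f) (sumL l g))
    where
    interchange : ∀ p q s t → p + q + (s + t) ≡ p + s + (q + t)
    interchange = solve-∀

  sumL-*ˡ : ∀ l c (f : A → ℤ) → sumL l (λ a → c * f a) ≡ c * sumL l f
  sumL-*ˡ []      c f = sym (ℤ.*-zeroʳ c)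
  sumL-*ˡ (a ∷ l) c f =
    trans (cong (_+_ (c * f a)) (sumL-*ˡ l c f)) (sym (ℤ.*-distribˡ-+ c (f a) (sumL l f)))

  sumL-*ʳ : ∀ l c (f : A → ℤ) → sumL l (λ a → f a * c) ≡ sumL l f * c
  sumL-*ʳ l c f =
    trans (sumL-cong l (λ a → ℤ.*-comm (f a) c)) (trans (sumL-*ˡ l c f) (ℤ.*-comm c _))

  sumL-zero : ∀ l (f : A → ℤ) → (∀ a → a ∈ l → f a ≡ 0ℤ) → sumL l f ≡ 0ℤ
  sumL-zero []      f f≡0 = refl
  sumL-zero (a ∷ l) f f≡0 =
    cong₂ _+_ (f≡0 a (here refl)) (sumL-zero l f (λ b b∈l → f≡0 b (there b∈l)))

  sumL-single : ∀ {l} → Unique l → (f : A → ℤ) {a : A} → a ∈ l →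
                (∀ b → b ≢ a → f b ≡ 0ℤ) → sumL l f ≡ f a
  sumL-single (a∉l ∷ _) f (here refl) f≡0 =
    trans (cong (_+_ (f _)) (sumL-zero _ f (λ b b∈l → f≡0 b (λ b≡a → All.lookup a∉l b∈l (sym b≡a)))))
          (ℤ.+-identityʳ _)
  sumL-single (b∉l ∷ l!) f (there a∈l) f≡0 =
    trans (cong₂ _+_ (f≡0 _ (λ b≡a → All.lookup b∉l a∈l b≡a)) (sumL-single l! f a∈l f≡0))
          (ℤ.+-identityˡ _)

  sumL-one : ∀ l → sumL l (λ _ → 1ℤ) ≡ + length l
  sumL-one []      = refl
  sumL-one (a ∷ l) = cong (_+_ 1ℤ) (sumL-one l)

sumL-swap : {A B : Set} (l : List A) (m : List B) (F : A → B → ℤ) →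
            sumL l (λ a → sumL m (F a)) ≡ sumL m (λ b → sumL l (λ a → F a b))
sumL-swap []      m F = sym (sumL-zero m (λ _ → 0ℤ) (λ _ _ → refl))
sumL-swap (a ∷ l) m F =
  trans (cong (_+_ (sumL m (F a))) (sumL-swap l m F)) (sym (sumL-+ m (F a) (λ b → sumL l (λ a → F a b))))

sumU : (r : ℕ) → (Vec Bool r → ℤ) → ℤ
sumU zero    f = f []
sumU (suc r) f = sumU r (f ∘ (false ∷_)) + sumU r (f ∘ (true ∷_))

sumU-cong : ∀ r {f g : Vec Bool r → ℤ} → (∀ w → f w ≡ g w) → sumU r f ≡ sumU r g
sumU-cong zero    f≗g = f≗g []
sumU-cong (suc r) f≗g =
  cong₂ _+_ (sumU-cong r (f≗g ∘ (false ∷_))) (sumU-cong r (f≗g ∘ (true ∷_)))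

sumU-+ : ∀ r (f g : Vec Bool r → ℤ) → sumU r (λ w → f w + g w) ≡ sumU r f + sumU r g
sumU-+ zero    f g = refl
sumU-+ (suc r) f g =
  trans (cong₂ _+_ (sumU-+ r (f ∘ (false ∷_)) (g ∘ (false ∷_))) (sumU-+ r (f ∘ (true ∷_)) (g ∘ (true ∷_))))
        (interchange (sumU r (f ∘ (false ∷_))) (sumU r (g ∘ (false ∷_)))
                     (sumU r (f ∘ (true ∷_))) (sumU r (g ∘ (true ∷_))))
  where
  interchange : ∀ p q s t → p + q + (s + t) ≡ p + s + (q + t)
  interchange = solve-∀

sumU-zero : ∀ r (f : Vec Bool r → ℤ) → (∀ w → f w ≡ 0ℤ) → sumU r f ≡ 0ℤ
sumU-zero zero    f f≡0 = f≡0 []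
sumU-zero (suc r) f f≡0 =
  cong₂ _+_ (sumU-zero r _ (f≡0 ∘ (false ∷_))) (sumU-zero r _ (f≡0 ∘ (true ∷_)))

sumU-single : ∀ r (f : Vec Bool r → ℤ) w₀ → (∀ w → w ≢ w₀ → f w ≡ 0ℤ) → sumU r f ≡ f w₀
sumU-single zero    f []           f≡0 = refl
sumU-single (suc r) f (false ∷ w₀) f≡0 =
  trans (cong₂ _+_ (sumU-single r _ w₀ (λ w w≢w₀ → f≡0 (false ∷ w) (w≢w₀ ∘ cong Data.Vec.tail)))
                   (sumU-zero r _ (λ w → f≡0 (true ∷ w) (λ ()))))
        (ℤ.+-identityʳ _)
sumU-single (suc r) f (true ∷ w₀)  f≡0 =
  trans (cong₂ _+_ (sumU-zero r _ (λ w → f≡0 (false ∷ w) (λ ())))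
                   (sumU-single r _ w₀ (λ w w≢w₀ → f≡0 (true ∷ w) (w≢w₀ ∘ cong Data.Vec.tail))))
        (ℤ.+-identityˡ _)

IsUnit : ℤ → Set
IsUnit z = z ≡ 1ℤ ⊎ z ≡ -1ℤ

IsUnit-* : ∀ {a b} → IsUnit a → IsUnit b → IsUnit (a * b)
IsUnit-* (inj₁ refl) (inj₁ refl) = inj₁ refl
IsUnit-* (inj₁ refl) (inj₂ refl) = inj₂ refl
IsUnit-* (inj₂ refl) (inj₁ refl) = inj₂ refl
IsUnit-* (inj₂ refl) (inj₂ refl) = inj₁ refl

IsUnit⇒square≡1 : ∀ {a} → IsUnit a → a * a ≡ 1ℤ
IsUnit⇒square≡1 (inj₁ refl) = refl
IsUnit⇒square≡1 (inj₂ refl) = refl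

sgn : Bool → ℤ
sgn b = if b then -1ℤ else 1ℤ

-- charValue u w = (-1)^{u·w} is the coefficient of x^w in χ_u.
charValue : ∀ {r} → Vec Bool r → Vec Bool r → ℤ
charValue []      []          = 1ℤ
charValue (b ∷ u) (false ∷ w) = charValue u w
charValue (b ∷ u) (true ∷ w)  = sgn b * charValue u w

sgn-isUnit : ∀ b → IsUnit (sgn b)
sgn-isUnit false = inj₁ refl
sgn-isUnit true  = inj₂ refl

charValue-isUnit : ∀ {r} (u w : Vec Bool r) → IsUnit (charValue u w)
charValue-isUnit []      []          = inj₁ refl
charValue-isUnit (b ∷ u) (false ∷ w) = charValue-isUnit u w
charValue-isUnit (b ∷ u) (true ∷ w)  = IsUnit-* (sgn-isUnit b) (charValue-isUnit u w)

charValue-zero : ∀ {r} (u : Vec Bool r) → charValue u (replicate r false) ≡ 1ℤ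
charValue-zero []      = refl
charValue-zero (b ∷ u) = charValue-zero u

module GroupRing (K : FinGroup) where

  open FinGroup K using (elems; complete; unique; order; assoc; identityˡ; identityʳ;
                         inverseˡ; inverseʳ; _≟_)
                  renaming (Carrier to C; _·_ to _∙_; e to ε; inv to _⁻¹)

  group : Group 0ℓ 0ℓ
  group = record
    { isGroup = record
      { isMonoid = record
        { isSemigroup = record
          { isMagma = record { isEquivalence = isEquivalence ; ∙-cong = cong₂ _∙_ }
          ; assoc = assoc }
        ; identity = identityˡ , identityʳ }
      ; inverse = inverseˡ , inverseʳ
      ; ⁻¹-cong = cong _⁻¹ } }

  open GroupProperties group
    using (ε⁻¹≈ε; ⁻¹-involutive; ⁻¹-anti-homo-∙; inverseʳ-unique;
           \\-leftDividesˡ; \\-leftDividesʳ; //-rightDividesˡ; //-rightDividesʳ)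

  infixl 7 _⊛_
  infixr 7 _•_
  infixl 6 _⊕_
  infix 4 _≈_

  ZK : Set
  ZK = Defs.ZK K

  sumK : (C → ℤ) → ℤ
  sumK = Defs.sumK K

  δ : C → ZK
  δ = Defs.δ K

  _⊕_ : ZK → ZK → ZK
  _⊕_ = Defs._⊕_ K

  _•_ : ℤ → ZK → ZK
  _•_ = Defs._•_ K

  𝟘 : ZK
  𝟘 = Defs.𝟘 K

  _⊛_ : ZK → ZK → ZK
  _⊛_ = Defs._⊛_ K

  _⁽⁻¹⁾ : ZK → ZK
  _⁽⁻¹⁾ = Defs._⁽⁻¹⁾ K

  _≈_ : ZK → ZK → Set
  _≈_ = Defs._≈_ K

  embed : ∀ {r} → (Fin r → C) → Vec Bool r → C
  embed = Defs.embed K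

  χ : ∀ {r} → (Fin r → C) → Vec Bool r → ZK
  χ = Defs.χ K

  module ≈-Reasoning = Relation.Binary.Reasoning.Setoid (C →-setoid ℤ)
  open Setoid (C →-setoid ℤ) using () renaming (sym to ≈-sym; trans to ≈-trans)

  sumK-cong : {f g : C → ℤ} → (∀ a → f a ≡ g a) → sumK f ≡ sumK g
  sumK-cong = sumL-cong elems

  sumK-single : (f : C → ℤ) (a : C) → (∀ b → b ≢ a → f b ≡ 0ℤ) → sumK f ≡ f a
  sumK-single f a = sumL-single unique f (complete a)

  δ-self : ∀ a → δ a a ≡ 1ℤ
  δ-self a with a ≟ a
  ... | yes _   = refl
  ... | no  a≢a = ⊥-elim (a≢a refl)

  δ-other : ∀ {a g} → a ≢ g → δ a g ≡ 0ℤ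
  δ-other {a} {g} a≢g with a ≟ g
  ... | yes a≡g = ⊥-elim (a≢g a≡g)
  ... | no  _   = refl

  δ-resp-⇔ : ∀ {a g a′ g′} → (a ≡ g → a′ ≡ g′) → (a′ ≡ g′ → a ≡ g) → δ a g ≡ δ a′ g′
  δ-resp-⇔ {a} {g} {a′} {g′} to from with a ≟ g | a′ ≟ g′
  ... | yes _   | yes _    = refl
  ... | no  _   | no  _    = refl
  ... | yes a≡g | no  a′≢g′ = ⊥-elim (a′≢g′ (to a≡g))
  ... | no  a≢g | yes a′≡g′ = ⊥-elim (a≢g (from a′≡g′))

  δ-translate : ∀ a b g → δ b (a ⁻¹ ∙ g) ≡ δ (a ∙ b) g
  δ-translate a b g = δ-resp-⇔ (λ b≡a⁻¹g → trans (cong (a ∙_) b≡a⁻¹g) (\\-leftDividesˡ a g))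
                               (λ ab≡g → trans (sym (\\-leftDividesʳ a b)) (cong (a ⁻¹ ∙_) ab≡g))

  δ-inverse : ∀ a g → δ a (g ⁻¹) ≡ δ (a ⁻¹) g
  δ-inverse a g = δ-resp-⇔ (λ a≡g⁻¹ → trans (cong _⁻¹ a≡g⁻¹) (⁻¹-involutive g))
                           (λ a⁻¹≡g → trans (sym (⁻¹-involutive a)) (cong _⁻¹ a⁻¹≡g))

  sumK-δ : ∀ a (F : C → ℤ) → sumK (λ h → δ a h * F h) ≡ F a
  sumK-δ a F =
    trans (sumK-single _ a (λ h h≢a → cong (_* F h) (δ-other (h≢a ∘ sym))))
          (trans (cong (_* F a) (δ-self a)) (ℤ.*-identityˡ (F a)))

  -- Reindexing is proved by expanding f (σ h) as Σ_k δ (σ h) k f k and swapping the sums.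
  sumK-reindex : (σ τ : C → C) → (∀ h → τ (σ h) ≡ h) → (∀ h → σ (τ h) ≡ h) →
                 (f : C → ℤ) → sumK (f ∘ σ) ≡ sumK f
  sumK-reindex σ τ τσ στ f = begin
      sumK (λ h → f (σ h))                          ≡⟨ sumK-cong (λ h → sumK-δ (σ h) f) ⟨
      sumK (λ h → sumK (λ k → δ (σ h) k * f k))     ≡⟨ sumL-swap elems elems _ ⟩
      sumK (λ k → sumK (λ h → δ (σ h) k * f k))     ≡⟨ sumK-cong (λ k → sumL-*ʳ elems (f k) _) ⟩
      sumK (λ k → sumK (λ h → δ (σ h) k) * f k)     ≡⟨ sumK-cong (λ k → cong (_* f k) (preimage k)) ⟩
      sumK (λ k → 1ℤ * f k)                         ≡⟨ sumK-cong (λ k → ℤ.*-identityˡ (f k)) ⟩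
      sumK f                                        ∎
    where
    open ≡-Reasoning
    preimage : ∀ k → sumK (λ h → δ (σ h) k) ≡ 1ℤ
    preimage k =
      trans (sumK-single _ (τ k) (λ h h≢τk → δ-other (λ σh≡k → h≢τk (trans (sym (τσ h)) (cong τ σh≡k)))))
            (trans (cong (λ a → δ a k) (στ k)) (δ-self k))

  sumK-translate : ∀ a (f : C → ℤ) → sumK (λ h → f (a ∙ h)) ≡ sumK f
  sumK-translate a = sumK-reindex (a ∙_) (a ⁻¹ ∙_) (\\-leftDividesʳ a) (\\-leftDividesˡ a)

  ⊛-cong : ∀ {F F′ G G′} → F ≈ F′ → G ≈ G′ → F ⊛ G ≈ F′ ⊛ G′
  ⊛-cong F≈F′ G≈G′ g = sumK-cong (λ h → cong₂ _*_ (F≈F′ h) (G≈G′ _))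

  ⊛-congˡ : ∀ {F F′} G → F ≈ F′ → F ⊛ G ≈ F′ ⊛ G
  ⊛-congˡ G F≈F′ = ⊛-cong {G = G} {G} F≈F′ (λ _ → refl)

  ⊛-congʳ : ∀ F {G G′} → G ≈ G′ → F ⊛ G ≈ F ⊛ G′
  ⊛-congʳ F = ⊛-cong {F} {F} (λ _ → refl)

  ⊛-assoc : ∀ F G H → (F ⊛ G) ⊛ H ≈ F ⊛ (G ⊛ H)
  ⊛-assoc F G H g = begin
      sumK (λ h → sumK (λ k → F k * G (k ⁻¹ ∙ h)) * H (h ⁻¹ ∙ g))
    ≡⟨ sumK-cong (λ h → sumL-*ʳ elems _ _) ⟨
      sumK (λ h → sumK (λ k → F k * G (k ⁻¹ ∙ h) * H (h ⁻¹ ∙ g)))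
    ≡⟨ sumL-swap elems elems _ ⟩
      sumK (λ k → sumK (λ h → F k * G (k ⁻¹ ∙ h) * H (h ⁻¹ ∙ g)))
    ≡⟨ sumK-cong (λ k → trans (sumK-cong (λ h → ℤ.*-assoc (F k) _ _)) (sumL-*ˡ elems (F k) _)) ⟩
      sumK (λ k → F k * sumK (λ h → G (k ⁻¹ ∙ h) * H (h ⁻¹ ∙ g)))
    ≡⟨ sumK-cong (λ k → cong (F k *_) (sumK-translate k _)) ⟨
      sumK (λ k → F k * sumK (λ m → G (k ⁻¹ ∙ (k ∙ m)) * H ((k ∙ m) ⁻¹ ∙ g)))
    ≡⟨ sumK-cong (λ k → cong (F k *_) (sumK-cong (λ m → cong₂ _*_
         (cong G (\\-leftDividesʳ k m))
         (cong H (trans (cong (_∙ g) (⁻¹-anti-homo-∙ k m)) (assoc _ _ _)))))) ⟩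
      sumK (λ k → F k * sumK (λ m → G m * H (m ⁻¹ ∙ (k ⁻¹ ∙ g))))
    ∎
    where open ≡-Reasoning

  ⊛-distribˡ-⊕ : ∀ F G H → F ⊛ (G ⊕ H) ≈ F ⊛ G ⊕ F ⊛ H
  ⊛-distribˡ-⊕ F G H g =
    trans (sumK-cong (λ h → ℤ.*-distribˡ-+ (F h) _ _)) (sumL-+ elems _ _)

  ⊛-distribʳ-⊕ : ∀ F G H → (F ⊕ G) ⊛ H ≈ F ⊛ H ⊕ G ⊛ H
  ⊛-distribʳ-⊕ F G H g =
    trans (sumK-cong (λ h → ℤ.*-distribʳ-+ (H _) (F h) _)) (sumL-+ elems _ _)

  •-⊛ : ∀ c F G → (c • F) ⊛ G ≈ c • (F ⊛ G)
  •-⊛ c F G g = trans (sumK-cong (λ h → ℤ.*-assoc c (F h) _)) (sumL-*ˡ elems c _)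

  ⊛-• : ∀ c F G → F ⊛ (c • G) ≈ c • (F ⊛ G)
  ⊛-• c F G g = trans (sumK-cong (λ h → swap (F h) c _)) (sumL-*ˡ elems c _)
    where
    swap : ∀ a b z → a * (b * z) ≡ b * (a * z)
    swap = solve-∀

  ⊛-zeroˡ : ∀ F → 𝟘 ⊛ F ≈ 𝟘
  ⊛-zeroˡ F g = sumL-zero elems _ (λ _ _ → refl)

  ⊛-zeroʳ : ∀ F → F ⊛ 𝟘 ≈ 𝟘
  ⊛-zeroʳ F g = sumL-zero elems _ (λ h _ → ℤ.*-zeroʳ (F h))

  δ-⊛ : ∀ a F g → (δ a ⊛ F) g ≡ F (a ⁻¹ ∙ g)
  δ-⊛ a F g = sumK-δ a (λ h → F (h ⁻¹ ∙ g))

  ⊛-δ : ∀ a F g → (F ⊛ δ a) g ≡ F (g ∙ a ⁻¹)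
  ⊛-δ a F g =
    trans (sumK-single _ (g ∙ a ⁻¹) off)
          (trans (cong (F (g ∙ a ⁻¹) *_) (trans (cong (δ a) hit) (δ-self a))) (ℤ.*-identityʳ _))
    where
    hit : (g ∙ a ⁻¹) ⁻¹ ∙ g ≡ a
    hit = trans (cong (_∙ g) (trans (⁻¹-anti-homo-∙ g (a ⁻¹)) (cong (_∙ g ⁻¹) (⁻¹-involutive a))))
                (//-rightDividesˡ g a)
    off : ∀ h → h ≢ g ∙ a ⁻¹ → F h * δ a (h ⁻¹ ∙ g) ≡ 0ℤ
    off h h≢ga⁻¹ = trans (cong (F h *_) (δ-other (λ a≡h⁻¹g → h≢ga⁻¹
      (trans (sym (//-rightDividesʳ a h)) (cong (_∙ a ⁻¹) (trans (cong (h ∙_) a≡h⁻¹g) (\\-leftDividesˡ h g)))))))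
      (ℤ.*-zeroʳ (F h))

  ⊛-identityˡ : ∀ F → δ ε ⊛ F ≈ F
  ⊛-identityˡ F g = trans (δ-⊛ ε F g) (cong F (trans (cong (_∙ g) ε⁻¹≈ε) (identityˡ g)))

  ⊛-identityʳ : ∀ F → F ⊛ δ ε ≈ F
  ⊛-identityʳ F g = trans (⊛-δ ε F g) (cong F (trans (cong (g ∙_) ε⁻¹≈ε) (identityʳ g)))

  ⁽⁻¹⁾-anti-homo-⊛ : ∀ F G → (F ⊛ G) ⁽⁻¹⁾ ≈ G ⁽⁻¹⁾ ⊛ F ⁽⁻¹⁾
  ⁽⁻¹⁾-anti-homo-⊛ F G g = begin
      sumK (λ h → F h * G (h ⁻¹ ∙ g ⁻¹))
    ≡⟨ sumK-cong (λ m → cong₂ _*_ (cong F (sym (recover m))) (cong G (sym (⁻¹-anti-homo-∙ g m)))) ⟩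
      sumK (λ m → F (((g ∙ m) ⁻¹ ∙ g) ⁻¹) * G ((g ∙ m) ⁻¹))
    ≡⟨ sumK-cong (λ m → ℤ.*-comm (F (((g ∙ m) ⁻¹ ∙ g) ⁻¹)) _) ⟩
      sumK (λ m → G ((g ∙ m) ⁻¹) * F (((g ∙ m) ⁻¹ ∙ g) ⁻¹))
    ≡⟨ sumK-translate g (λ h → G (h ⁻¹) * F ((h ⁻¹ ∙ g) ⁻¹)) ⟩
      sumK (λ h → G (h ⁻¹) * F ((h ⁻¹ ∙ g) ⁻¹))
    ∎
    where
    open ≡-Reasoning
    recover : ∀ m → ((g ∙ m) ⁻¹ ∙ g) ⁻¹ ≡ m
    recover m = trans (cong _⁻¹ (trans (cong (_∙ g) (⁻¹-anti-homo-∙ g m)) (//-rightDividesˡ g (m ⁻¹))))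
                      (⁻¹-involutive m)

  ⊛⁽⁻¹⁾-at-ε : ∀ F G → (F ⊛ G ⁽⁻¹⁾) ε ≡ sumK (λ h → F h * G h)
  ⊛⁽⁻¹⁾-at-ε F G = sumK-cong (λ h → cong (λ a → F h * G a)
                                        (trans (cong _⁻¹ (identityʳ (h ⁻¹))) (⁻¹-involutive h)))

  ⊛⁽⁻¹⁾-self-at-ε : ∀ F → (∀ g → IsUnit (F g)) → (F ⊛ F ⁽⁻¹⁾) ε ≡ + order
  ⊛⁽⁻¹⁾-self-at-ε F unit =
    trans (⊛⁽⁻¹⁾-at-ε F F) (trans (sumK-cong (IsUnit⇒square≡1 ∘ unit)) (sumL-one elems))

  ⊛-middle-swap : ∀ P X Q Y → X ⊛ Q ≈ Q ⊛ X → (P ⊛ X) ⊛ (Q ⊛ Y) ≈ (P ⊛ Q) ⊛ (X ⊛ Y)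
  ⊛-middle-swap P X Q Y XQ≈QX = begin
    (P ⊛ X) ⊛ (Q ⊛ Y)   ≈⟨ ⊛-assoc P X (Q ⊛ Y) ⟩
    P ⊛ (X ⊛ (Q ⊛ Y))   ≈⟨ ⊛-congʳ P (⊛-assoc X Q Y) ⟨
    P ⊛ ((X ⊛ Q) ⊛ Y)   ≈⟨ ⊛-congʳ P (⊛-congˡ Y XQ≈QX) ⟩
    P ⊛ ((Q ⊛ X) ⊛ Y)   ≈⟨ ⊛-congʳ P (⊛-assoc Q X Y) ⟩
    P ⊛ (Q ⊛ (X ⊛ Y))   ≈⟨ ⊛-assoc P Q (X ⊛ Y) ⟨
    (P ⊛ Q) ⊛ (X ⊛ Y)   ∎
    where open ≈-Reasoning

  ⊛-comm-prodZK : ∀ n F (G : Fin n → ZK) → (∀ i → F ⊛ G i ≈ G i ⊛ F) →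
                  F ⊛ Defs.prodZK K n G ≈ Defs.prodZK K n G ⊛ F
  ⊛-comm-prodZK zero    F G _  = λ g → trans (⊛-identityʳ F g) (sym (⊛-identityˡ F g))
  ⊛-comm-prodZK (suc n) F G FG≈GF = begin
    F ⊛ (G zero ⊛ R)   ≈⟨ ⊛-assoc F (G zero) R ⟨
    (F ⊛ G zero) ⊛ R   ≈⟨ ⊛-congˡ R (FG≈GF zero) ⟩
    (G zero ⊛ F) ⊛ R   ≈⟨ ⊛-assoc (G zero) F R ⟩
    G zero ⊛ (F ⊛ R)   ≈⟨ ⊛-congʳ (G zero) (⊛-comm-prodZK n F (G ∘ suc) (FG≈GF ∘ suc)) ⟩
    G zero ⊛ (R ⊛ F)   ≈⟨ ⊛-assoc (G zero) R F ⟨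
    (G zero ⊛ R) ⊛ F   ∎
    where
    open ≈-Reasoning
    R = Defs.prodZK K n (G ∘ suc)

  factor : ℤ → C → ZK
  factor s a = δ ε ⊕ s • δ a

  factor-⊛ : ∀ s a F g → (factor s a ⊛ F) g ≡ F g + s * F (a ⁻¹ ∙ g)
  factor-⊛ s a F g = trans (⊛-distribʳ-⊕ (δ ε) (s • δ a) F g)
    (cong₂ _+_ (⊛-identityˡ F g) (trans (•-⊛ s (δ a) F g) (cong (s *_) (δ-⊛ a F g))))

  ⊛-factor : ∀ s a F g → (F ⊛ factor s a) g ≡ F g + s * F (g ∙ a ⁻¹)
  ⊛-factor s a F g = trans (⊛-distribˡ-⊕ F (δ ε) (s • δ a) g)
    (cong₂ _+_ (⊛-identityʳ F g) (trans (⊛-• s F (δ a) g) (cong (s *_) (⊛-δ a F g))))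

  factor-⊛-factor : ∀ s t a b g →
    (factor s a ⊛ factor t b) g ≡ δ ε g + t * δ b g + s * (δ a g + t * δ (a ∙ b) g)
  factor-⊛-factor s t a b g =
    trans (factor-⊛ s a (factor t b) g)
          (cong (λ z → δ ε g + t * δ b g + s * z)
                (cong₂ (λ p q → p + t * q) (trans (δ-translate a ε g) (cong (λ c → δ c g) (identityʳ a)))
                                           (δ-translate a b g)))

  factor-comm : ∀ s t {a b} → a ∙ b ≡ b ∙ a → factor s a ⊛ factor t b ≈ factor t b ⊛ factor s a
  factor-comm s t {a} {b} ab≡ba g = begin
      (factor s a ⊛ factor t b) g
    ≡⟨ factor-⊛-factor s t a b g ⟩
      δ ε g + t * δ b g + s * (δ a g + t * δ (a ∙ b) g)
    ≡⟨ symmetric s t (δ ε g) (δ a g) (δ b g) (δ (a ∙ b) g) ⟩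
      δ ε g + s * δ a g + t * (δ b g + s * δ (a ∙ b) g)
    ≡⟨ cong (λ c → δ ε g + s * δ a g + t * (δ b g + s * δ c g)) ab≡ba ⟩
      δ ε g + s * δ a g + t * (δ b g + s * δ (b ∙ a) g)
    ≡⟨ factor-⊛-factor t s b a g ⟨
      (factor t b ⊛ factor s a) g
    ∎
    where
    open ≡-Reasoning
    symmetric : ∀ s t e a b ab → e + t * b + s * (a + t * ab) ≡ e + s * a + t * (b + s * ab)
    symmetric = solve-∀

  factor-square : ∀ s t {a} → a ∙ a ≡ ε →
                  ∀ g → (factor s a ⊛ factor t a) g ≡ (1ℤ + s * t) * δ ε g + (s + t) * δ a g
  factor-square s t {a} aa≡ε g =
    trans (factor-⊛-factor s t a a g)
          (trans (cong (λ c → δ ε g + t * δ a g + s * (δ a g + t * δ c g)) aa≡ε)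
                 (collect s t (δ ε g) (δ a g)))
    where
    collect : ∀ s t e a → e + t * a + s * (a + t * e) ≡ (1ℤ + s * t) * e + (s + t) * a
    collect = solve-∀

  factor-idem : ∀ b {a} → a ∙ a ≡ ε → factor (sgn b) a ⊛ factor (sgn b) a ≈ + 2 • factor (sgn b) a
  factor-idem false {a} aa≡ε g = trans (factor-square 1ℤ 1ℤ aa≡ε g) (idem (δ ε g) (δ a g))
    where
    idem : ∀ e a → (1ℤ + 1ℤ * 1ℤ) * e + (1ℤ + 1ℤ) * a ≡ + 2 * (e + 1ℤ * a)
    idem = solve-∀
  factor-idem true  {a} aa≡ε g = trans (factor-square -1ℤ -1ℤ aa≡ε g) (idem (δ ε g) (δ a g))
    where
    idem : ∀ e a → (1ℤ + -1ℤ * -1ℤ) * e + (-1ℤ + -1ℤ) * a ≡ + 2 * (e + -1ℤ * a)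
    idem = solve-∀

  factor-orth : ∀ b c {a} → b ≢ c → a ∙ a ≡ ε → factor (sgn b) a ⊛ factor (sgn c) a ≈ 𝟘
  factor-orth false false b≢c _ = ⊥-elim (b≢c refl)
  factor-orth true  true  b≢c _ = ⊥-elim (b≢c refl)
  factor-orth false true  {a} _ aa≡ε g = trans (factor-square 1ℤ -1ℤ aa≡ε g) (annihilate (δ ε g) (δ a g))
    where
    annihilate : ∀ e a → (1ℤ + 1ℤ * -1ℤ) * e + (1ℤ + -1ℤ) * a ≡ 0ℤ
    annihilate = solve-∀
  factor-orth true  false {a} _ aa≡ε g = trans (factor-square -1ℤ 1ℤ aa≡ε g) (annihilate (δ ε g) (δ a g))
    where
    annihilate : ∀ e a → (1ℤ + -1ℤ * 1ℤ) * e + (-1ℤ + 1ℤ) * a ≡ 0ℤ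
    annihilate = solve-∀

  δ-⁽⁻¹⁾ : ∀ {a} → a ⁻¹ ≡ a → δ a ⁽⁻¹⁾ ≈ δ a
  δ-⁽⁻¹⁾ {a} a⁻¹≡a g = trans (δ-inverse a g) (cong (λ c → δ c g) a⁻¹≡a)

  factor-⁽⁻¹⁾ : ∀ s {a} → a ∙ a ≡ ε → factor s a ⁽⁻¹⁾ ≈ factor s a
  factor-⁽⁻¹⁾ s {a} aa≡ε g =
    cong₂ (λ p q → p + s * q) (δ-⁽⁻¹⁾ ε⁻¹≈ε g) (δ-⁽⁻¹⁾ (sym (inverseʳ-unique a a aa≡ε)) g)

  record CommutingInvolutions {r : ℕ} (x : Fin r → C) : Set where
    field
      invol   : ∀ i → x i ∙ x i ≡ ε
      commute : ∀ i j → x i ∙ x j ≡ x j ∙ x i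

  open CommutingInvolutions

  tail : ∀ {r} {x : Fin (suc r) → C} → CommutingInvolutions x → CommutingInvolutions (x ∘ suc)
  tail ci = record { invol = invol ci ∘ suc ; commute = λ i j → commute ci (suc i) (suc j) }

  -- For x over Fin (suc r), the character χ x (b ∷ u) unfolds to factor (sgn b) (x zero) ⊛ χ (x ∘ suc) u.
  factor-comm-χ : ∀ {r} {x : Fin (suc r) → C} → CommutingInvolutions x → ∀ s u →
                  factor s (x zero) ⊛ χ (x ∘ suc) u ≈ χ (x ∘ suc) u ⊛ factor s (x zero)
  factor-comm-χ {r} {x} ci s u =
    ⊛-comm-prodZK r (factor s (x zero)) (λ i → factor (sgn (lookup u i)) (x (suc i)))
                  (λ i → factor-comm s (sgn (lookup u i)) (commute ci zero (suc i)))

  χ-idem : ∀ {r} {x : Fin r → C} → CommutingInvolutions x → ∀ u → χ x u ⊛ χ x u ≈ + (2 ^ r) • χ x u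
  χ-idem {zero}  ci []      g = trans (⊛-identityˡ (δ ε) g) (sym (ℤ.*-identityˡ _))
  χ-idem {suc r} {x} ci (b ∷ u) = begin
    (P ⊛ X) ⊛ (P ⊛ X)             ≈⟨ ⊛-middle-swap P X P X (≈-sym (factor-comm-χ ci (sgn b) u)) ⟩
    (P ⊛ P) ⊛ (X ⊛ X)             ≈⟨ ⊛-cong (factor-idem b (invol ci zero)) (χ-idem (tail ci) u) ⟩
    (+ 2 • P) ⊛ (+ (2 ^ r) • X)   ≈⟨ •-⊛ (+ 2) P (+ (2 ^ r) • X) ⟩
    + 2 • (P ⊛ (+ (2 ^ r) • X))   ≈⟨ (λ g → cong (+ 2 *_) (⊛-• (+ (2 ^ r)) P X g)) ⟩
    + 2 • + (2 ^ r) • (P ⊛ X)     ≈⟨ (λ g → trans (sym (ℤ.*-assoc (+ 2) (+ (2 ^ r)) _)) (cong (_* (P ⊛ X) g) (sym (ℤ.pos-* 2 (2 ^ r))))) ⟩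
    + (2 ^ suc r) • (P ⊛ X)       ∎
    where
    open ≈-Reasoning
    P = factor (sgn b) (x zero)
    X = χ (x ∘ suc) u

  χ-orth : ∀ {r} {x : Fin r → C} → CommutingInvolutions x → ∀ u v → u ≢ v → χ x u ⊛ χ x v ≈ 𝟘
  χ-orth {zero}      ci []      []      []≢[] = ⊥-elim ([]≢[] refl)
  χ-orth {suc r} {x} ci (b ∷ u) (c ∷ v) bu≢cv = begin
    (P b ⊛ X) ⊛ (P c ⊛ Y)   ≈⟨ ⊛-middle-swap (P b) X (P c) Y (≈-sym (factor-comm-χ ci (sgn c) u)) ⟩
    (P b ⊛ P c) ⊛ (X ⊛ Y)   ≈⟨ one-factor-vanishes (b Data.Bool.≟ c) ⟩
    𝟘                       ∎
    where
    open ≈-Reasoning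
    P : Bool → ZK
    P b = factor (sgn b) (x zero)
    X = χ (x ∘ suc) u
    Y = χ (x ∘ suc) v
    one-factor-vanishes : Dec (b ≡ c) → (P b ⊛ P c) ⊛ (X ⊛ Y) ≈ 𝟘
    one-factor-vanishes (yes refl) =
      ≈-trans (⊛-congʳ (P b ⊛ P c) (χ-orth (tail ci) u v (bu≢cv ∘ cong (b ∷_)))) (⊛-zeroʳ (P b ⊛ P c))
    one-factor-vanishes (no b≢c) =
      ≈-trans (⊛-congˡ (X ⊛ Y) (factor-orth b c b≢c (invol ci zero))) (⊛-zeroˡ (X ⊛ Y))

  χ-⁽⁻¹⁾ : ∀ {r} {x : Fin r → C} → CommutingInvolutions x → ∀ u → χ x u ⁽⁻¹⁾ ≈ χ x u
  χ-⁽⁻¹⁾ {zero}      ci []      = δ-⁽⁻¹⁾ ε⁻¹≈ε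
  χ-⁽⁻¹⁾ {suc r} {x} ci (b ∷ u) = begin
    (P ⊛ X) ⁽⁻¹⁾        ≈⟨ ⁽⁻¹⁾-anti-homo-⊛ P X ⟩
    X ⁽⁻¹⁾ ⊛ P ⁽⁻¹⁾     ≈⟨ ⊛-cong (χ-⁽⁻¹⁾ (tail ci) u) (factor-⁽⁻¹⁾ (sgn b) (invol ci zero)) ⟩
    X ⊛ P               ≈⟨ factor-comm-χ ci (sgn b) u ⟨
    P ⊛ X               ∎
    where
    open ≈-Reasoning
    P = factor (sgn b) (x zero)
    X = χ (x ∘ suc) u

  ∙-comm-embed : ∀ {r} (x : Fin r → C) a → (∀ i → a ∙ x i ≡ x i ∙ a) →
                 ∀ w → a ∙ embed x w ≡ embed x w ∙ a
  ∙-comm-embed x a _ [] = trans (identityʳ a) (sym (identityˡ a))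
  ∙-comm-embed x a ax≡xa (c ∷ w) = begin
    a ∙ (y ∙ m)   ≡⟨ assoc a y m ⟨
    a ∙ y ∙ m     ≡⟨ cong (_∙ m) (comm-y c) ⟩
    y ∙ a ∙ m     ≡⟨ assoc y a m ⟩
    y ∙ (a ∙ m)   ≡⟨ cong (y ∙_) (∙-comm-embed (x ∘ suc) a (ax≡xa ∘ suc) w) ⟩
    y ∙ (m ∙ a)   ≡⟨ assoc y m a ⟨
    y ∙ m ∙ a     ∎
    where
    open ≡-Reasoning
    y = if c then x zero else ε
    m = embed (x ∘ suc) w
    comm-y : ∀ c → a ∙ (if c then x zero else ε) ≡ (if c then x zero else ε) ∙ a
    comm-y true  = ax≡xa zero
    comm-y false = trans (identityʳ a) (sym (identityˡ a))

  embed-zero : ∀ {r} (x : Fin r → C) → embed x (replicate r false) ≡ ε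
  embed-zero {zero}  x = refl
  embed-zero {suc r} x = trans (identityˡ _) (embed-zero (x ∘ suc))

  ⊛χ-expand : ∀ {r} {x : Fin r → C} → CommutingInvolutions x → ∀ u F g →
              (F ⊛ χ x u) g ≡ sumU r (λ w → charValue u w * F (g ∙ embed x w))
  ⊛χ-expand {zero}      ci []      F g =
    trans (⊛-identityʳ F g) (sym (trans (ℤ.*-identityˡ _) (cong F (identityʳ g))))
  ⊛χ-expand {suc r} {x} ci (b ∷ u) F g = begin
      (F ⊛ (P ⊛ X)) g
    ≡⟨ ⊛-assoc F P X g ⟨
      ((F ⊛ P) ⊛ X) g
    ≡⟨ ⊛χ-expand (tail ci) u (F ⊛ P) g ⟩
      sumU r (λ w → charValue u w * (F ⊛ P) (g ∙ m w))
    ≡⟨ sumU-cong r split ⟩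
      sumU r (λ w → charValue u w * F (g ∙ (ε ∙ m w)) + sgn b * charValue u w * F (g ∙ (a ∙ m w)))
    ≡⟨ sumU-+ r _ _ ⟩
      sumU (suc r) (λ w → charValue (b ∷ u) w * F (g ∙ embed x w))
    ∎
    where
    open ≡-Reasoning
    a = x zero
    P = factor (sgn b) a
    X = χ (x ∘ suc) u
    m = embed (x ∘ suc)
    shift : ∀ w → g ∙ m w ∙ a ⁻¹ ≡ g ∙ (a ∙ m w)
    shift w = trans (cong (g ∙ m w ∙_) (sym (inverseʳ-unique a a (invol ci zero))))
                    (trans (assoc g (m w) a)
                           (cong (g ∙_) (sym (∙-comm-embed (x ∘ suc) a (commute ci zero ∘ suc) w))))
    distribute : ∀ c s f₀ f₁ → c * (f₀ + s * f₁) ≡ c * f₀ + s * c * f₁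
    distribute = solve-∀
    split : ∀ w → charValue u w * (F ⊛ P) (g ∙ m w)
                ≡ charValue u w * F (g ∙ (ε ∙ m w)) + sgn b * charValue u w * F (g ∙ (a ∙ m w))
    split w = trans (cong (charValue u w *_) (⊛-factor (sgn b) a F (g ∙ m w)))
                    (trans (cong₂ (λ p q → charValue u w * (F p + sgn b * F q))
                                  (cong (g ∙_) (sym (identityˡ (m w)))) (shift w))
                           (distribute (charValue u w) (sgn b) (F (g ∙ (ε ∙ m w))) (F (g ∙ (a ∙ m w)))))

  χ-at-ε : ∀ {r} {x : Fin r → C} → CommutingInvolutions x →
           (∀ w → embed x w ≡ ε → w ≡ replicate r false) → ∀ u → χ x u ε ≡ 1ℤ
  χ-at-ε {r} {x} ci trivialKernel u = begin
      χ x u ε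
    ≡⟨ ⊛-identityˡ (χ x u) ε ⟨
      (δ ε ⊛ χ x u) ε
    ≡⟨ ⊛χ-expand ci u (δ ε) ε ⟩
      sumU r (λ w → charValue u w * δ ε (ε ∙ embed x w))
    ≡⟨ sumU-single r _ (replicate r false) off ⟩
      charValue u (replicate r false) * δ ε (ε ∙ embed x (replicate r false))
    ≡⟨ cong₂ _*_ (charValue-zero u)
                 (trans (cong (δ ε) (trans (identityˡ _) (embed-zero x))) (δ-self ε)) ⟩
      1ℤ
    ∎
    where
    open ≡-Reasoning
    off : ∀ w → w ≢ replicate r false → charValue u w * δ ε (ε ∙ embed x w) ≡ 0ℤ
    off w w≢0 = trans (cong (charValue u w *_)
                            (δ-other (λ ε≡εm → w≢0 (trivialKernel w (sym (trans ε≡εm (identityˡ _)))))))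
                      (ℤ.*-zeroʳ (charValue u w))

  ⊛χ-isUnit : ∀ {r} {x : Fin r → C} → CommutingInvolutions x → ∀ {A} → Defs.IsOnCosetReps K x A →
              ∀ u g → IsUnit ((A ⊛ χ x u) g)
  ⊛χ-isUnit {r} {x} ci {A} (values , onePerCoset , atMostOne) u g =
    subst IsUnit (sym expansion) (IsUnit-* (charValue-isUnit u w₀) A-unit)
    where
    w₀ = proj₁ (onePerCoset g)
    A≢0 = proj₂ (onePerCoset g)
    A-unit : IsUnit (A (g ∙ embed x w₀))
    A-unit with values (g ∙ embed x w₀)
    ... | inj₁ A≡0 = ⊥-elim (A≢0 A≡0)
    ... | inj₂ pm1 = pm1
    off : ∀ w → w ≢ w₀ → charValue u w * A (g ∙ embed x w) ≡ 0ℤ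
    off w w≢w₀ with A (g ∙ embed x w) ℤ.≟ 0ℤ
    ... | yes A≡0 = trans (cong (charValue u w *_) A≡0) (ℤ.*-zeroʳ (charValue u w))
    ... | no  A≢0′ = ⊥-elim (w≢w₀ (atMostOne g w w₀ A≢0′ A≢0))
    expansion : (A ⊛ χ x u) g ≡ charValue u w₀ * A (g ∙ embed x w₀)
    expansion = trans (⊛χ-expand ci u A g) (sumU-single r _ w₀ off)

  module SignatureSet {r} {x : Fin r → C} (N : Defs.IsNormalC2r K r x)
                      {A : Vec Bool r → ZK} (sig : Defs.IsSignatureSet K x A) where

    ci : CommutingInvolutions x
    ci = record { invol = Defs.IsNormalC2r.invol N ; commute = Defs.IsNormalC2r.commute N }

    trivialKernel : ∀ w → embed x w ≡ ε → w ≡ replicate r false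
    trivialKernel w x^w≡ε =
      Defs.IsNormalC2r.injective N w (replicate r false) (trans x^w≡ε (sym (embed-zero x)))

    B : Vec Bool r → ZK
    B u = A u ⊛ χ x u

    B-isUnit : ∀ u g → IsUnit (B u g)
    B-isUnit u = ⊛χ-isUnit ci (proj₁ (sig u)) u

    B⊛B⁽⁻¹⁾ : ∀ u v → B u ⊛ B v ⁽⁻¹⁾ ≈ (A u ⊛ (χ x u ⊛ χ x v)) ⊛ A v ⁽⁻¹⁾
    B⊛B⁽⁻¹⁾ u v = begin
      B u ⊛ (A v ⊛ χ x v) ⁽⁻¹⁾             ≈⟨ ⊛-congʳ (B u) (⁽⁻¹⁾-anti-homo-⊛ (A v) (χ x v)) ⟩
      B u ⊛ (χ x v ⁽⁻¹⁾ ⊛ A v ⁽⁻¹⁾)        ≈⟨ ⊛-congʳ (B u) (⊛-congˡ (A v ⁽⁻¹⁾) (χ-⁽⁻¹⁾ ci v)) ⟩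
      B u ⊛ (χ x v ⊛ A v ⁽⁻¹⁾)             ≈⟨ ⊛-assoc (B u) (χ x v) (A v ⁽⁻¹⁾) ⟨
      (B u ⊛ χ x v) ⊛ A v ⁽⁻¹⁾             ≈⟨ ⊛-congˡ (A v ⁽⁻¹⁾) (⊛-assoc (A u) (χ x u) (χ x v)) ⟩
      (A u ⊛ (χ x u ⊛ χ x v)) ⊛ A v ⁽⁻¹⁾   ∎
      where open ≈-Reasoning

    B-orth : ∀ u v → u ≢ v → B u ⊛ B v ⁽⁻¹⁾ ≈ 𝟘
    B-orth u v u≢v = begin
      B u ⊛ B v ⁽⁻¹⁾                       ≈⟨ B⊛B⁽⁻¹⁾ u v ⟩
      (A u ⊛ (χ x u ⊛ χ x v)) ⊛ A v ⁽⁻¹⁾   ≈⟨ ⊛-congˡ (A v ⁽⁻¹⁾) (⊛-congʳ (A u) (χ-orth ci u v u≢v)) ⟩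
      (A u ⊛ 𝟘) ⊛ A v ⁽⁻¹⁾                 ≈⟨ ⊛-congˡ (A v ⁽⁻¹⁾) (⊛-zeroʳ (A u)) ⟩
      𝟘 ⊛ A v ⁽⁻¹⁾                         ≈⟨ ⊛-zeroˡ (A v ⁽⁻¹⁾) ⟩
      𝟘                                     ∎
      where open ≈-Reasoning

    scale : ℤ
    scale = + (2 ^ r) * + Defs.indexE K r

    B⊛B⁽⁻¹⁾-self : ∀ u → B u ⊛ B u ⁽⁻¹⁾ ≈ scale • χ x u
    B⊛B⁽⁻¹⁾-self u = begin
      B u ⊛ B u ⁽⁻¹⁾                               ≈⟨ B⊛B⁽⁻¹⁾ u u ⟩
      (A u ⊛ (χ x u ⊛ χ x u)) ⊛ A u ⁽⁻¹⁾           ≈⟨ ⊛-congˡ (A u ⁽⁻¹⁾) (⊛-congʳ (A u) (χ-idem ci u)) ⟩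
      (A u ⊛ (+ (2 ^ r) • χ x u)) ⊛ A u ⁽⁻¹⁾       ≈⟨ ⊛-congˡ (A u ⁽⁻¹⁾) (⊛-• (+ (2 ^ r)) (A u) (χ x u)) ⟩
      (+ (2 ^ r) • B u) ⊛ A u ⁽⁻¹⁾                 ≈⟨ •-⊛ (+ (2 ^ r)) (B u) (A u ⁽⁻¹⁾) ⟩
      + (2 ^ r) • ((B u) ⊛ A u ⁽⁻¹⁾)               ≈⟨ (λ g → cong (+ (2 ^ r) *_) (proj₂ (sig u) g)) ⟩
      + (2 ^ r) • + Defs.indexE K r • χ x u        ≈⟨ (λ g → sym (ℤ.*-assoc (+ (2 ^ r)) _ _)) ⟩
      scale • χ x u                                ∎
      where open ≈-Reasoning

    B-self : ∀ u → B u ⊛ B u ⁽⁻¹⁾ ≈ + order • χ x u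
    B-self u g = trans (B⊛B⁽⁻¹⁾-self u g) (cong (_* χ x u g) scale≡order)
      where
      open ≡-Reasoning
      scale≡order : scale ≡ + order
      scale≡order = begin
        scale                       ≡⟨ ℤ.*-identityʳ scale ⟨
        scale * 1ℤ                  ≡⟨ cong (scale *_) (χ-at-ε ci trivialKernel u) ⟨
        scale * χ x u ε             ≡⟨ B⊛B⁽⁻¹⁾-self u ε ⟨
        (B u ⊛ B u ⁽⁻¹⁾) ε          ≡⟨ ⊛⁽⁻¹⁾-self-at-ε (B u) (B-isUnit u) ⟩
        + order                     ∎

open Defs using (Carrier; IsNormalC2r; ZK; IsSignatureSet; IsPM1; _⊛_; χ; _≈_; _⁽⁻¹⁾; _•_; order; 𝟘)

lemma2p2 : (K : FinGroup) (r : ℕ) (x : Fin r → Carrier K) → IsNormalC2r K r x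
         → (A : Vec Bool r → ZK K) → IsSignatureSet K x A
         → (∀ u g → IsPM1 K (_⊛_ K (A u) (χ K x u) g))
           × (∀ u v → (u ≡ v → _≈_ K (_⊛_ K (_⊛_ K (A u) (χ K x u)) (_⁽⁻¹⁾ K (_⊛_ K (A v) (χ K x v)))) (_•_ K (+ order K) (χ K x u)))
                    × (u ≢ v → _≈_ K (_⊛_ K (_⊛_ K (A u) (χ K x u)) (_⁽⁻¹⁾ K (_⊛_ K (A v) (χ K x v)))) (𝟘 K)))
lemma2p2 K r x N A sig = B-isUnit , λ u v → (λ { refl → B-self u }) , B-orth u v
  where open GroupRing.SignatureSet K N sig
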